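{- Let $K$ be an even integer, let $m,n\ge2$ be integers and $L=\mathrm{lcm}[m,n]$. Then: (a) if $\omega_K(m)=\omega_K(n)=t$ for some $t\in\{1,2,4\}$, then $\omega_K(L)=t$; (b) if one of $\omega_K(m),\omega_K(n)$ equals $2$ and the other equals $4$, then $\omega_K(L)=2$; (c) if one of $\omega_K(m),\omega_K(n)$ equals $1$ and the other equals $2$ or $4$, then $\omega_K(L)\in\{1,2\}$.
   Context: For an integer $K$, the $K$-Fibonacci sequence is $F_{K,0}=0$, $F_{K,1}=1$, $F_{K,n}=KF_{K,n-1}+F_{K,n-2}$ for $n\ge2$. For an integer $m\ge 2$, $\pi_K(m)$ is the least positive period of $(F_{K,n}\bmod m)$ and $\omega_K(m)$ is the number of indices $0\le j<\pi_K(m)$ with $m\mid F_{K,j}$; it takes values in $\{1,2,4\}$. -}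

module Defs where

open import Data.Nat as ℕ using (ℕ; zero; suc; _<_; _≤_)
open import Data.Nat.Divisibility using (_∣?_)
open import Data.Integer as ℤ using (ℤ; +_; _*_; _+_; _-_; ∣_∣)
open import Data.Integer.Divisibility renaming (_∣_ to _∣ℤ_)
open import Data.List using (List; length; filter; upTo)
open import Data.Product using (_×_; ∃)
open import Relation.Binary.PropositionalEquality using (_≡_)

F : ℤ → ℕ → ℤ
F K zero = + 0
F K (suc zero) = + 1
F K (suc (suc n)) = K * F K (suc n) + F K n

IsPeriod : ℤ → ℕ → ℕ → Set
IsPeriod K m p = 0 < p × (∀ i → (+ m) ∣ℤ (F K (i ℕ.+ p) - F K i))

IsLeastPeriod : ℤ → ℕ → ℕ → Set
IsLeastPeriod K m p = IsPeriod K m p × (∀ q → IsPeriod K m q → p ≤ q)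

-- number of indices 0 ≤ j < p with m ∣ F_{K,j}
-- (m ∣ x in ℤ is by definition m ∣ ∣x∣ in ℕ)
zeroCount : ℤ → ℕ → ℕ → ℕ
zeroCount K m p = length (filter (λ j → m ∣? ∣ F K j ∣) (upTo p))

Omega : ℤ → ℕ → ℕ → Set
Omega K m t = ∃ λ p → IsLeastPeriod K m p × zeroCount K m p ≡ t

Even : ℤ → Set
Even K = (+ 2) ∣ℤ K

{-# OPTIONS --safe #-}
module Submission where

-- Let α be the rank of apparition of M, the least j > 0 with M ∣ F_j. By Cassini's identity
-- F_{α+1} F_{α-1} - F_α² = ±1, the number F_{α-1} is a unit modulo M, so the zeros of F modulo M
-- are exactly the multiples of α; and q is a period of F modulo M iff M ∣ F_q and M ∣ F_{q+1} - 1.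
-- Hence π(M) = ω(M) α(M), and since both zeros and periods modulo lcm m n are those common to m
-- and n, α(lcm m n) = lcm (α m) (α n) and π(lcm m n) = lcm (π m) (π n). So ω(lcm m n) is
-- lcm (ω_m α_m) (ω_n α_n) / lcm α_m α_n, and the three cases are arithmetic of lcm once the parity
-- of α is known. For this, F_{2α+1} = F_{α+1}² + F_α² ≡ (-1)^α modulo M: if α is even then 2α is
-- a period, so ω ≠ 4; if α is odd and ω ∈ {1, 2} then 2α is a period, so M ∣ 2, and M = 2 is
-- impossible because for even K the terms of odd index are odd.

open import Defs
open import Data.Integer.Base using (ℤ; +_; _+_; _*_; _-_; ∣_∣; 0ℤ; 1ℤ; -1ℤ; _^_)
import Data.Integer.Properties as ℤ
open import Data.Integer.Divisibility.Signed as ℤ∣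
  using (∣ᵤ⇒∣; ∣⇒∣ᵤ) renaming (_∣_ to _∣ℤ_)
open import Data.Integer.Tactic.RingSolver using (solve-∀)
open import Data.List.Base using ([_]; _++_; length; filter; upTo)
open import Data.List.Properties
  using (upTo-∷ʳ; filter-++; length-++; filter-accept; filter-reject)
open import Data.Nat.Base as ℕ using (ℕ; zero; suc; _≤_; _<_; s≤s; >-nonZero)
open import Data.Nat.Properties
  using (+-comm; +-assoc; +-suc; +-identityʳ; *-assoc; *-zeroʳ; ≤-refl; ≤-antisym; <⇒≤; <⇒≱;
         ≮⇒≥; n≢0⇒n>0; 0≢1+n; _≟_; _<?_; anyUpTo?)
open import Data.Nat.Divisibility
  using (_∣_; divides; _∣?_; _∣0; 1∣_; ∣-refl; ∣-trans; ∣-antisym; ∣⇒≤; ∣1⇒≡1; n∣m*n; m∣m*n;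
         ∣m∣n⇒∣m+n; ∣m+n∣m⇒∣n; *-monoʳ-∣; *-monoˡ-∣; *-cancelˡ-∣; *-cancelʳ-∣; m%n≡0⇒n∣m;
         quotient; m∣n⇒n≡quotient*m; m∣n⇒n≡m*quotient)
open import Data.Nat.DivMod using (_%_; _/_; m≡m%n+[m/n]*n; m%n<n)
open import Data.Nat.GCD using (gcd)
open import Data.Nat.LCM
  using (lcm; m∣lcm[m,n]; n∣lcm[m,n]; lcm-least; lcm-comm; gcd*lcm; lcm[0,n]≡0)
open import Data.Nat.Primality using (prime[2]; euclidsLemma; prime⇒irreducible)
open import Data.Nat.Induction using (<-rec)
open import Data.Product.Base using (_×_; _,_; proj₁; proj₂; ∃; uncurry)
open import Data.Product.Function.NonDependent.Propositional using (_×-⇔_)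
open import Data.Sum.Base as Sum using (_⊎_; inj₁; inj₂)
open import Function.Base using (_∘_; flip)
open import Function.Bundles using (_⇔_; mk⇔; Equivalence)
import Function.Properties.Equivalence as ⇔
open import Relation.Nullary using (¬_; yes; no; contradiction)
open import Relation.Nullary.Decidable using (_×-dec_)
open import Relation.Unary using (Pred; Decidable)
open import Relation.Binary.PropositionalEquality
  using (_≡_; refl; sym; trans; cong; cong₂; subst; subst₂; module ≡-Reasoning)

open Equivalence using (to; from)
open ≡-Reasoning

-- Least elements, translation-invariant sets and counting in ℕ

least-witness : ∀ {ℓ} {P : Pred ℕ ℓ} → Decidable P → ∀ {n} → P n →
                ∃ λ a → P a × (∀ {j} → P j → a ≤ j)
least-witness {P = P} P? {n} = <-rec Goal search n
  where
  Goal : Pred ℕ _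
  Goal n = P n → ∃ λ a → P a × (∀ {j} → P j → a ≤ j)
  search : ∀ n → (∀ {m} → m < n → Goal m) → Goal n
  search n smaller Pn with anyUpTo? P? n
  ... | yes (m , m<n , Pm) = smaller m<n Pm
  ... | no  none           = n , Pn , λ Pj → ≮⇒≥ λ j<n → none (_ , j<n , Pj)

module _ {ℓ} {P : Pred ℕ ℓ} {a : ℕ} (shift : ∀ j → P (a ℕ.+ j) ⇔ P j) where

  private
    shift-* : ∀ k j → P (k ℕ.* a ℕ.+ j) ⇔ P j
    shift-* zero    j = ⇔.refl
    shift-* (suc k) j = ⇔.trans
      (subst (λ i → P i ⇔ P (k ℕ.* a ℕ.+ j)) (sym (+-assoc a (k ℕ.* a) j)) (shift _))
      (shift-* k j)

  multiples-of-least : P 0 → 0 < a → (∀ {j} → 0 < j → P j → a ≤ j) → ∀ j → P j ⇔ a ∣ j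
  multiples-of-least P0 a>0 least j = mk⇔ divides-j j-multiple
    where
    instance _ = >-nonZero a>0
    j-multiple : a ∣ j → P j
    j-multiple (divides k j≡ka) =
      subst P (trans (+-identityʳ (k ℕ.* a)) (sym j≡ka)) (from (shift-* k 0) P0)
    divides-j : P j → a ∣ j
    divides-j Pj with j % a ≟ 0
    ... | yes r≡0 = m%n≡0⇒n∣m j a r≡0
    ... | no  r≢0 = contradiction (least (n≢0⇒n>0 r≢0) Pr) (<⇒≱ (m%n<n j a))
      where
      Pr : P (j % a)
      Pr = to (shift-* (j / a) (j % a))
              (subst P (trans (m≡m%n+[m/n]*n j a) (+-comm (j % a) _)) Pj)

countUpTo : ∀ {ℓ} {P : Pred ℕ ℓ} → Decidable P → ℕ → ℕ
countUpTo P? n = length (filter P? (upTo n))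

module _ {ℓ} {P : Pred ℕ ℓ} (P? : Decidable P) where

  private
    countUpTo-suc : ∀ n → countUpTo P? (suc n) ≡ countUpTo P? n ℕ.+ length (filter P? [ n ])
    countUpTo-suc n = begin
      length (filter P? (upTo (suc n)))               ≡⟨ cong (length ∘ filter P?) (upTo-∷ʳ n) ⟨
      length (filter P? (upTo n ++ [ n ]))            ≡⟨ cong length (filter-++ P? (upTo n) [ n ]) ⟩
      length (filter P? (upTo n) ++ filter P? [ n ])  ≡⟨ length-++ (filter P? (upTo n)) ⟩
      countUpTo P? n ℕ.+ length (filter P? [ n ])     ∎

  countUpTo-accept : ∀ {n} → P n → countUpTo P? (suc n) ≡ suc (countUpTo P? n)
  countUpTo-accept {n} Pn = begin
    countUpTo P? (suc n)                         ≡⟨ countUpTo-suc n ⟩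
    countUpTo P? n ℕ.+ length (filter P? [ n ])
      ≡⟨ cong ((countUpTo P? n ℕ.+_) ∘ length) (filter-accept P? Pn) ⟩
    countUpTo P? n ℕ.+ 1                         ≡⟨ +-comm _ 1 ⟩
    suc (countUpTo P? n)                         ∎

  countUpTo-reject : ∀ {n} → ¬ P n → countUpTo P? (suc n) ≡ countUpTo P? n
  countUpTo-reject {n} ¬Pn = begin
    countUpTo P? (suc n)                         ≡⟨ countUpTo-suc n ⟩
    countUpTo P? n ℕ.+ length (filter P? [ n ])
      ≡⟨ cong ((countUpTo P? n ℕ.+_) ∘ length) (filter-reject P? ¬Pn) ⟩
    countUpTo P? n ℕ.+ 0                         ≡⟨ +-identityʳ _ ⟩
    countUpTo P? n                               ∎

  countUpTo-multiples : ∀ {d} → 0 < d → (∀ j → P j ⇔ d ∣ j) → ∀ k → countUpTo P? (k ℕ.* d) ≡ k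
  countUpTo-multiples {d@(suc b)} _ P⇔d∣ = count
    where
    one-per-block : ∀ k r → r ≤ b →
                    countUpTo P? (k ℕ.* d ℕ.+ suc r) ≡ suc (countUpTo P? (k ℕ.* d))
    one-per-block k zero    _   =
      trans (cong (countUpTo P?) (+-comm _ 1)) (countUpTo-accept (from (P⇔d∣ _) (n∣m*n k)))
    one-per-block k (suc r) r<b = begin
      countUpTo P? (k ℕ.* d ℕ.+ suc (suc r))  ≡⟨ cong (countUpTo P?) (+-suc _ (suc r)) ⟩
      countUpTo P? (suc (k ℕ.* d ℕ.+ suc r))  ≡⟨ countUpTo-reject (off-multiple ∘ to (P⇔d∣ _)) ⟩
      countUpTo P? (k ℕ.* d ℕ.+ suc r)        ≡⟨ one-per-block k r (<⇒≤ r<b) ⟩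
      suc (countUpTo P? (k ℕ.* d))            ∎
      where
      off-multiple : ¬ d ∣ k ℕ.* d ℕ.+ suc r
      off-multiple d∣ = <⇒≱ (s≤s r<b) (∣⇒≤ (∣m+n∣m⇒∣n d∣ (n∣m*n k)))
    count : ∀ k → countUpTo P? (k ℕ.* d) ≡ k
    count zero    = refl
    count (suc k) = begin
      countUpTo P? (d ℕ.+ k ℕ.* d)  ≡⟨ cong (countUpTo P?) (+-comm d _) ⟩
      countUpTo P? (k ℕ.* d ℕ.+ d)  ≡⟨ one-per-block k b ≤-refl ⟩
      suc (countUpTo P? (k ℕ.* d))  ≡⟨ cong suc (count k) ⟩
      suc k                         ∎

-- Least common multiples

lcm-∣⇔ : ∀ {m n x} → lcm m n ∣ x ⇔ ((m ∣ x) × (n ∣ x))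
lcm-∣⇔ {m} {n} = mk⇔
  (λ l∣x → ∣-trans (m∣lcm[m,n] m n) l∣x , ∣-trans (n∣lcm[m,n] m n) l∣x)
  (uncurry lcm-least)

lcm-pos : ∀ {m n} → 0 < m → 0 < n → 0 < lcm m n
lcm-pos {m@(suc _)} {n@(suc _)} _ _ = n≢0⇒n>0 λ lcm≡0 → 0≢1+n (begin
  0                    ≡⟨ *-zeroʳ (gcd m n) ⟨
  gcd m n ℕ.* 0        ≡⟨ cong (gcd m n ℕ.*_) lcm≡0 ⟨
  gcd m n ℕ.* lcm m n  ≡⟨ gcd*lcm m n ⟩
  m ℕ.* n              ∎)

lcm[ta,tb]≡t*lcm[a,b] : ∀ t a b → lcm (t ℕ.* a) (t ℕ.* b) ≡ t ℕ.* lcm a b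
lcm[ta,tb]≡t*lcm[a,b] zero      _ _ = lcm[0,n]≡0 0
lcm[ta,tb]≡t*lcm[a,b] t@(suc _) a b = ∣-antisym
  (lcm-least (*-monoʳ-∣ t (m∣lcm[m,n] a b)) (*-monoʳ-∣ t (n∣lcm[m,n] a b)))
  (subst (t ℕ.* lcm a b ∣_) (sym L≡tc)
    (*-monoʳ-∣ t (lcm-least (cancel (m∣lcm[m,n] (t ℕ.* a) (t ℕ.* b)))
                            (cancel (n∣lcm[m,n] (t ℕ.* a) (t ℕ.* b))))))
  where
  L = lcm (t ℕ.* a) (t ℕ.* b)
  t∣L : t ∣ L
  t∣L = ∣-trans (m∣m*n a) (m∣lcm[m,n] _ _)
  L≡tc : L ≡ t ℕ.* quotient t∣L
  L≡tc = m∣n⇒n≡m*quotient t∣L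
  cancel : ∀ {x} → t ℕ.* x ∣ L → x ∣ quotient t∣L
  cancel tx∣L = *-cancelˡ-∣ t (subst (_ ∣_) L≡tc tx∣L)

4b∣2*lcm[a,b] : ∀ {a b} → 2 ∣ a → ¬ 2 ∣ b → 4 ℕ.* b ∣ 2 ℕ.* lcm a b
4b∣2*lcm[a,b] {a} {b} 2∣a 2∤b =
  subst₂ _∣_ (sym (*-assoc 2 2 b)) (cong (2 ℕ.*_) (sym lcm≡cb)) (*-monoʳ-∣ 2 (*-monoˡ-∣ b 2∣c))
  where
  c = quotient (n∣lcm[m,n] a b)
  lcm≡cb : lcm a b ≡ c ℕ.* b
  lcm≡cb = m∣n⇒n≡quotient*m (n∣lcm[m,n] a b)
  2∣c : 2 ∣ c
  2∣c with euclidsLemma c b prime[2] (subst (2 ∣_) lcm≡cb (∣-trans 2∣a (m∣lcm[m,n] a b)))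
  ... | inj₁ 2∣c = 2∣c
  ... | inj₂ 2∣b = contradiction 2∣b 2∤b

lcm[2a,4b]≡2*lcm[a,b] : ∀ {a b} → 2 ∣ a → ¬ 2 ∣ b → lcm (2 ℕ.* a) (4 ℕ.* b) ≡ 2 ℕ.* lcm a b
lcm[2a,4b]≡2*lcm[a,b] {a} {b} 2∣a 2∤b = ∣-antisym
  (lcm-least (*-monoʳ-∣ 2 (m∣lcm[m,n] a b)) (4b∣2*lcm[a,b] 2∣a 2∤b))
  (subst (_∣ lcm (2 ℕ.* a) (4 ℕ.* b)) (lcm[ta,tb]≡t*lcm[a,b] 2 a b)
    (lcm-least (m∣lcm[m,n] (2 ℕ.* a) (4 ℕ.* b))
               (∣-trans (*-monoˡ-∣ b (divides {2} {4} 2 refl)) (n∣lcm[m,n] (2 ℕ.* a) _))))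

∣-between-double : ∀ {c d} → 0 < d → d ∣ c → c ∣ 2 ℕ.* d → c ≡ 1 ℕ.* d ⊎ c ≡ 2 ℕ.* d
∣-between-double {c} {d} d>0 (divides k c≡kd) c∣2d
  with prime⇒irreducible prime[2] {k}
         (*-cancelʳ-∣ d {{>-nonZero d>0}} (subst (_∣ 2 ℕ.* d) c≡kd c∣2d))
... | inj₁ refl = inj₁ c≡kd
... | inj₂ refl = inj₂ c≡kd

lcm-between : ∀ {a b c d} → 0 < lcm a b → a ∣ c → b ∣ d →
              c ∣ 2 ℕ.* lcm a b → d ∣ 2 ℕ.* lcm a b →
              lcm c d ≡ 1 ℕ.* lcm a b ⊎ lcm c d ≡ 2 ℕ.* lcm a b
lcm-between {c = c} {d} A>0 a∣c b∣d c∣2A d∣2A = ∣-between-double A>0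
  (lcm-least (∣-trans a∣c (m∣lcm[m,n] c d)) (∣-trans b∣d (n∣lcm[m,n] c d)))
  (lcm-least c∣2A d∣2A)

-- Identities for F

F-+ : ∀ K i j → F K (i ℕ.+ suc j) ≡ F K (suc i) * F K (suc j) + F K i * F K j
F-+ K zero          j = base (F K (suc j)) (F K j)
  where
  base : ∀ x y → x ≡ + 1 * x + + 0 * y
  base = solve-∀
F-+ K (suc zero)    j = base K (F K (suc j)) (F K j)
  where
  base : ∀ K x y → K * x + y ≡ (K * + 1 + + 0) * x + + 1 * y
  base = solve-∀
F-+ K (suc (suc i)) j = begin
  K * F K (suc i ℕ.+ suc j) + F K (i ℕ.+ suc j)
    ≡⟨ cong₂ (λ u v → K * u + v) (F-+ K (suc i) j) (F-+ K i j) ⟩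
  K * (F K (suc (suc i)) * F K (suc j) + F K (suc i) * F K j)
    + (F K (suc i) * F K (suc j) + F K i * F K j)
    ≡⟨ recurrence K (F K (suc i)) (F K i) (F K (suc j)) (F K j) ⟩
  F K (suc (suc (suc i))) * F K (suc j) + F K (suc (suc i)) * F K j
    ∎
  where
  recurrence : ∀ K a b c d → K * ((K * a + b) * c + a * d) + (a * c + b * d)
                           ≡ (K * (K * a + b) + a) * c + (K * a + b) * d
  recurrence = solve-∀

F-cassini : ∀ K n → F K (suc (suc n)) * F K n - F K (suc n) * F K (suc n) ≡ -1ℤ ^ suc n
F-cassini K zero    = base K
  where
  base : ∀ K → (K * + 1 + + 0) * + 0 - + 1 * + 1 ≡ -1ℤ * 1ℤ
  base = solve-∀
F-cassini K (suc n) =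
  trans (alternate K (F K (suc n)) (F K n)) (cong (-1ℤ *_) (F-cassini K n))
  where
  alternate : ∀ K x y → (K * (K * x + y) + x) * x - (K * x + y) * (K * x + y)
                      ≡ -1ℤ * ((K * x + y) * y - x * x)
  alternate = solve-∀

private
  -1*-1*x≡x : ∀ x → -1ℤ * (-1ℤ * x) ≡ x
  -1*-1*x≡x = solve-∀

-1^even : ∀ n → 2 ∣ n → -1ℤ ^ n ≡ 1ℤ
-1^even zero          _     = refl
-1^even (suc zero)    2∣1   = contradiction (∣1⇒≡1 2∣1) λ ()
-1^even (suc (suc n)) 2∣2+n = trans (-1*-1*x≡x _) (-1^even n (∣m+n∣m⇒∣n 2∣2+n ∣-refl))

-1^odd : ∀ n → ¬ 2 ∣ n → -1ℤ ^ n ≡ -1ℤ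
-1^odd zero          2∤0   = contradiction (2 ∣0) 2∤0
-1^odd (suc zero)    _     = refl
-1^odd (suc (suc n)) 2∤2+n = trans (-1*-1*x≡x _) (-1^odd n (2∤2+n ∘ ∣m∣n⇒∣m+n ∣-refl))

-1^n*-1^n : ∀ n → -1ℤ ^ n * -1ℤ ^ n ≡ 1ℤ
-1^n*-1^n zero    = refl
-1^n*-1^n (suc n) = trans (square (-1ℤ ^ n)) (-1^n*-1^n n)
  where
  square : ∀ x → -1ℤ * x * (-1ℤ * x) ≡ x * x
  square = solve-∀

F-odd : ∀ {K} → Even K → ∀ j → ¬ 2 ∣ j → ¬ (+ 2 ∣ℤ F K j)
F-odd     _   zero          2∤0   _   = 2∤0 (2 ∣0)
F-odd     _   (suc zero)    _     2∣1 = contradiction (∣1⇒≡1 (∣⇒∣ᵤ 2∣1)) λ ()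
F-odd {K} 2∣K (suc (suc j)) 2∤2+j 2∣F = F-odd {K} 2∣K j (2∤2+j ∘ ∣m∣n⇒∣m+n ∣-refl)
  (ℤ∣.∣m+n∣m⇒∣n 2∣F (ℤ∣.∣m⇒∣m*n (F K (suc j)) (∣ᵤ⇒∣ {k = + 2} {i = K} 2∣K)))

-- Periods modulo M

∣ᵤ⇔∣ : ∀ {M x} → M ∣ ∣ x ∣ ⇔ + M ∣ℤ x
∣ᵤ⇔∣ = mk⇔ ∣ᵤ⇒∣ ∣⇒∣ᵤ

∣ℤ0 : ∀ M → + M ∣ℤ 0ℤ
∣ℤ0 M = ∣ᵤ⇒∣ (M ∣0)

ShiftInvariant : ℤ → ℕ → ℕ → Set
ShiftInvariant K M s = ∀ i → + M ∣ℤ F K (i ℕ.+ s) - F K i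

module _ {K : ℤ} {M : ℕ} where

  isPeriod⇒shiftInvariant : ∀ {q} → IsPeriod K M q → ShiftInvariant K M q
  isPeriod⇒shiftInvariant (_ , invariant) = ∣ᵤ⇒∣ ∘ invariant

  shiftInvariant⇒isPeriod : ∀ {q} → 0 < q → ShiftInvariant K M q → IsPeriod K M q
  shiftInvariant⇒isPeriod q>0 invariant = q>0 , ∣⇒∣ᵤ ∘ invariant

  shiftInvariant⇒∣F : ∀ {s} → ShiftInvariant K M s → + M ∣ℤ F K s
  shiftInvariant⇒∣F {s} invariant = subst (+ M ∣ℤ_) (ℤ.+-identityʳ (F K s)) (invariant 0)

  shiftInvariant⇒∣F[1+]-1 : ∀ {s} → ShiftInvariant K M s → + M ∣ℤ F K (suc s) - 1ℤ
  shiftInvariant⇒∣F[1+]-1 invariant = invariant 1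

  shiftInvariant-intro : ∀ {s} → + M ∣ℤ F K s → + M ∣ℤ F K (suc s) - 1ℤ → ShiftInvariant K M s
  shiftInvariant-intro {s} M∣F[s] M∣F[1+s]-1 = invariant
    where
    difference : ∀ K a b c d → K * (a - c) + (b - d) ≡ (K * a + b) - (K * c + d)
    difference = solve-∀
    invariant : ShiftInvariant K M s
    invariant zero          = subst (+ M ∣ℤ_) (sym (ℤ.+-identityʳ (F K s))) M∣F[s]
    invariant (suc zero)    = M∣F[1+s]-1
    invariant (suc (suc i)) =
      subst (+ M ∣ℤ_) (difference K (F K (suc i ℕ.+ s)) (F K (i ℕ.+ s)) (F K (suc i)) (F K i))
        (ℤ∣.∣m∣n⇒∣m+n (ℤ∣.∣n⇒∣m*n K (invariant (suc i))) (invariant i))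

  shiftInvariant-shift : ∀ {p} → ShiftInvariant K M p →
                         ∀ s → ShiftInvariant K M (p ℕ.+ s) ⇔ ShiftInvariant K M s
  shiftInvariant-shift {p} invariant-p s = mk⇔ down up
    where
    cancel : ∀ a b c → (a - c) - (a - b) ≡ b - c
    cancel = solve-∀
    telescope : ∀ a b c → (a - b) + (b - c) ≡ a - c
    telescope = solve-∀
    step : ∀ i → + M ∣ℤ F K (i ℕ.+ (p ℕ.+ s)) - F K (i ℕ.+ s)
    step i = subst (λ k → + M ∣ℤ F K k - F K (i ℕ.+ s))
                   (trans (+-assoc i s p) (cong (i ℕ.+_) (+-comm s p)))
                   (invariant-p (i ℕ.+ s))
    down : ShiftInvariant K M (p ℕ.+ s) → ShiftInvariant K M s
    down invariant i =
      subst (+ M ∣ℤ_) (cancel (F K (i ℕ.+ (p ℕ.+ s))) (F K (i ℕ.+ s)) (F K i))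
        (ℤ∣.∣m∣n⇒∣m-n (invariant i) (step i))
    up : ShiftInvariant K M s → ShiftInvariant K M (p ℕ.+ s)
    up invariant i =
      subst (+ M ∣ℤ_) (telescope (F K (i ℕ.+ (p ℕ.+ s))) (F K (i ℕ.+ s)) (F K i))
        (ℤ∣.∣m∣n⇒∣m+n (step i) (invariant i))

  leastPeriod-∣⇔ : ∀ {p} → IsLeastPeriod K M p → ∀ q → ShiftInvariant K M q ⇔ p ∣ q
  leastPeriod-∣⇔ (period@(p>0 , _) , least) =
    multiples-of-least {P = ShiftInvariant K M}
      (shiftInvariant-shift (isPeriod⇒shiftInvariant period))
      (shiftInvariant-intro (∣ℤ0 M) (∣ℤ0 M)) p>0
      (λ q>0 invariant → least _ (shiftInvariant⇒isPeriod q>0 invariant))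

-- The rank of apparition and ω

-- Encoded by its characteristic property; rank-exists shows that the least positive zero has it.
IsRankOfApparition : ℤ → ℕ → ℕ → Set
IsRankOfApparition K M α = 0 < α × (∀ j → + M ∣ℤ F K j ⇔ α ∣ j)

module _ {K : ℤ} {M : ℕ} where

  -- Cassini: F_{β+2} F_β - F_{β+1}² = ±1, so F_β is a unit modulo any divisor of F_{β+1}.
  F-cancelʳ-∣ : ∀ {β x} → + M ∣ℤ F K (suc β) → + M ∣ℤ x * F K β → + M ∣ℤ x
  F-cancelʳ-∣ {β} {x} M∣F[1+β] M∣xF[β] = subst (+ M ∣ℤ_) x*σ*σ≡x (ℤ∣.∣m⇒∣m*n σ M∣xσ)
    where
    σ = -1ℤ ^ suc β
    factor : ∀ a b c x → a * (x * b) - x * c * c ≡ x * (a * b - c * c)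
    factor = solve-∀
    M∣xσ : + M ∣ℤ x * σ
    M∣xσ = subst (+ M ∣ℤ_)
      (trans (factor (F K (suc (suc β))) (F K β) (F K (suc β)) x) (cong (x *_) (F-cassini K β)))
      (ℤ∣.∣m∣n⇒∣m-n (ℤ∣.∣n⇒∣m*n (F K (suc (suc β))) M∣xF[β])
                    (ℤ∣.∣n⇒∣m*n (x * F K (suc β)) M∣F[1+β]))
    x*σ*σ≡x : x * σ * σ ≡ x
    x*σ*σ≡x = begin
      x * σ * σ    ≡⟨ ℤ.*-assoc x σ σ ⟩
      x * (σ * σ)  ≡⟨ cong (x *_) (-1^n*-1^n (suc β)) ⟩
      x * 1ℤ       ≡⟨ ℤ.*-identityʳ x ⟩
      x            ∎

  zeros-shift : ∀ {α} → + M ∣ℤ F K α → ∀ j → (+ M ∣ℤ F K (α ℕ.+ j)) ⇔ (+ M ∣ℤ F K j)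
  zeros-shift {zero}  _      j = ⇔.refl
  zeros-shift {suc β} M∣F[α] j = mk⇔ down up
    where
    expand : F K (suc β ℕ.+ j) ≡ F K (suc j) * F K (suc β) + F K j * F K β
    expand = trans (cong (F K) (+-comm (suc β) j)) (F-+ K j β)
    M∣F[1+j]F[α] : + M ∣ℤ F K (suc j) * F K (suc β)
    M∣F[1+j]F[α] = ℤ∣.∣n⇒∣m*n (F K (suc j)) M∣F[α]
    down : + M ∣ℤ F K (suc β ℕ.+ j) → + M ∣ℤ F K j
    down M∣F =
      F-cancelʳ-∣ {β} M∣F[α] (ℤ∣.∣m+n∣m⇒∣n (subst (+ M ∣ℤ_) expand M∣F) M∣F[1+j]F[α])
    up : + M ∣ℤ F K j → + M ∣ℤ F K (suc β ℕ.+ j)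
    up M∣F[j] = subst (+ M ∣ℤ_) (sym expand)
      (ℤ∣.∣m∣n⇒∣m+n M∣F[1+j]F[α] (ℤ∣.∣m⇒∣m*n (F K β) M∣F[j]))

  rank-exists : ∀ {p} → IsPeriod K M p → ∃ (IsRankOfApparition K M)
  rank-exists period@(p>0 , _)
    with least-witness (λ j → (0 <? j) ×-dec (M ∣? ∣ F K j ∣))
                       (p>0 , ∣⇒∣ᵤ (shiftInvariant⇒∣F (isPeriod⇒shiftInvariant period)))
  ... | α , (α>0 , M∣F[α]) , least = α , α>0 ,
    multiples-of-least {P = λ j → + M ∣ℤ F K j} (zeros-shift {α} (∣ᵤ⇒∣ M∣F[α])) (∣ℤ0 M) α>0
      (λ j>0 M∣F[j] → least (j>0 , ∣⇒∣ᵤ M∣F[j]))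

  zeroCount-multiple : ∀ {α} → IsRankOfApparition K M α → ∀ k → zeroCount K M (k ℕ.* α) ≡ k
  zeroCount-multiple (α>0 , zeros) =
    countUpTo-multiples (λ j → M ∣? ∣ F K j ∣) α>0 (λ j → ⇔.trans (∣ᵤ⇔∣ {x = F K j}) (zeros j))

  omega⇒leastPeriod : ∀ {t} → Omega K M t →
                      ∃ λ α → IsRankOfApparition K M α × IsLeastPeriod K M (t ℕ.* α)
  omega⇒leastPeriod {t} (p , least@(period , _) , count≡t) with rank-exists period
  ... | α , rank with to (proj₂ rank p) (shiftInvariant⇒∣F (isPeriod⇒shiftInvariant period))
  ... | divides k p≡kα =
    α , rank , subst (IsLeastPeriod K M) (trans p≡kα (cong (ℕ._* α) k≡t)) least
    where
    k≡t : k ≡ t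
    k≡t = begin
      k                        ≡⟨ zeroCount-multiple rank k ⟨
      zeroCount K M (k ℕ.* α)  ≡⟨ cong (zeroCount K M) p≡kα ⟨
      zeroCount K M p          ≡⟨ count≡t ⟩
      t                        ∎

  leastPeriod⇒omega : ∀ {α t} → IsRankOfApparition K M α → IsLeastPeriod K M (t ℕ.* α) →
                      Omega K M t
  leastPeriod⇒omega {α} {t} rank least = t ℕ.* α , least , zeroCount-multiple rank t

  -- Parity of the rank of apparition

  ∣F[1+2α]-[-1]^α : ∀ {α} → + M ∣ℤ F K α → + M ∣ℤ F K (suc (2 ℕ.* α)) - -1ℤ ^ α
  ∣F[1+2α]-[-1]^α {zero}      _      = ∣ℤ0 M
  ∣F[1+2α]-[-1]^α {α@(suc β)} M∣F[α] =
    subst (+ M ∣ℤ_) (sym F[1+2α]-σ≡c*a) (ℤ∣.∣n⇒∣m*n c M∣F[α])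
    where
    a = F K α
    b = F K β
    s = F K (suc α)
    σ = -1ℤ ^ α
    c = s * K + + 2 * a
    1+2α≡α+[1+α] : suc (2 ℕ.* α) ≡ α ℕ.+ suc α
    1+2α≡α+[1+α] = trans (cong (λ k → suc (α ℕ.+ k)) (+-identityʳ α)) (sym (+-suc α α))
    regroup : ∀ K a b σ → (K * a + b) * (K * a + b) + a * a - σ
                        ≡ ((K * a + b) * K + + 2 * a) * a + (((K * a + b) * b - a * a) - σ)
    regroup = solve-∀
    F[1+2α]-σ≡c*a : F K (suc (2 ℕ.* α)) - σ ≡ c * a
    F[1+2α]-σ≡c*a = begin
      F K (suc (2 ℕ.* α)) - σ        ≡⟨ cong (λ k → F K k - σ) 1+2α≡α+[1+α] ⟩
      F K (α ℕ.+ suc α) - σ          ≡⟨ cong (_- σ) (F-+ K α α) ⟩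
      s * s + a * a - σ              ≡⟨ regroup K a b σ ⟩
      c * a + ((s * b - a * a) - σ)  ≡⟨ cong (λ v → c * a + (v - σ)) (F-cassini K β) ⟩
      c * a + (σ - σ)                ≡⟨ cong (λ v → c * a + v) (ℤ.+-inverseʳ σ) ⟩
      c * a + 0ℤ                     ≡⟨ ℤ.+-identityʳ (c * a) ⟩
      c * a                          ∎

  shiftInvariant-2α : ∀ {α} → IsRankOfApparition K M α → 2 ∣ α → ShiftInvariant K M (2 ℕ.* α)
  shiftInvariant-2α {α} (_ , zeros) 2∣α = shiftInvariant-intro
    (from (zeros (2 ℕ.* α)) (n∣m*n 2))
    (subst (λ σ → + M ∣ℤ F K (suc (2 ℕ.* α)) - σ) (-1^even α 2∣α)
      (∣F[1+2α]-[-1]^α {α} (from (zeros α) ∣-refl)))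

  rank-odd : ∀ {α} → IsRankOfApparition K M α → IsLeastPeriod K M (4 ℕ.* α) → ¬ 2 ∣ α
  rank-odd {α} rank@(α>0 , _) least 2∣α = contradiction (∣⇒≤ 4∣2) λ { (s≤s (s≤s ())) }
    where
    4α∣2α : 4 ℕ.* α ∣ 2 ℕ.* α
    4α∣2α = to (leastPeriod-∣⇔ least _) (shiftInvariant-2α rank 2∣α)
    4∣2 : 4 ∣ 2
    4∣2 = *-cancelʳ-∣ α {{>-nonZero α>0}} 4α∣2α

  rank-even : ∀ {α t} → Even K → 2 ≤ M → IsRankOfApparition K M α →
              IsLeastPeriod K M (t ℕ.* α) → t ∣ 2 → 2 ∣ α
  rank-even {α} 2∣K M≥2 (_ , zeros) least t∣2 with 2 ∣? α
  ... | yes 2∣α = 2∣α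
  ... | no  2∤α = contradiction (subst (λ d → + d ∣ℤ F K α) M≡2 M∣F[α]) (F-odd 2∣K α 2∤α)
    where
    M∣F[α] : + M ∣ℤ F K α
    M∣F[α] = from (zeros α) ∣-refl
    M∣F[1+2α]-1 : + M ∣ℤ F K (suc (2 ℕ.* α)) - 1ℤ
    M∣F[1+2α]-1 = shiftInvariant⇒∣F[1+]-1 (from (leastPeriod-∣⇔ least _) (*-monoˡ-∣ α t∣2))
    M∣F[1+2α]+1 : + M ∣ℤ F K (suc (2 ℕ.* α)) - -1ℤ
    M∣F[1+2α]+1 = subst (λ σ → + M ∣ℤ F K (suc (2 ℕ.* α)) - σ) (-1^odd α 2∤α)
                    (∣F[1+2α]-[-1]^α {α} M∣F[α])
    difference : ∀ x → (x - -1ℤ) - (x - 1ℤ) ≡ + 2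
    difference = solve-∀
    M∣2 : + M ∣ℤ + 2
    M∣2 = subst (+ M ∣ℤ_) (difference (F K (suc (2 ℕ.* α))))
            (ℤ∣.∣m∣n⇒∣m-n M∣F[1+2α]+1 M∣F[1+2α]-1)
    M≡2 : M ≡ 2
    M≡2 = ≤-antisym (∣⇒≤ (∣⇒∣ᵤ M∣2)) M≥2

-- The modulus lcm m n

module _ {K : ℤ} {m n : ℕ} where

  isRank-lcm : ∀ {a b} → IsRankOfApparition K m a → IsRankOfApparition K n b →
               IsRankOfApparition K (lcm m n) (lcm a b)
  isRank-lcm (a>0 , zeros-m) (b>0 , zeros-n) = lcm-pos a>0 b>0 , λ j →
    ⇔.trans (⇔.sym ∣ᵤ⇔∣) (⇔.trans lcm-∣⇔ (⇔.trans (∣ᵤ⇔∣ ×-⇔ ∣ᵤ⇔∣)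
      (⇔.trans (zeros-m j ×-⇔ zeros-n j) (⇔.sym lcm-∣⇔))))

  leastPeriod-lcm : ∀ {p q} → IsLeastPeriod K m p → IsLeastPeriod K n q →
                    IsLeastPeriod K (lcm m n) (lcm p q)
  leastPeriod-lcm {p} {q} least-m@((p>0 , _) , _) least-n@((q>0 , _) , _) = period , minimal
    where
    period : IsPeriod K (lcm m n) (lcm p q)
    period = lcm-pos p>0 q>0 , λ i → from lcm-∣⇔
      ( ∣⇒∣ᵤ (from (leastPeriod-∣⇔ least-m _) (m∣lcm[m,n] p q) i)
      , ∣⇒∣ᵤ (from (leastPeriod-∣⇔ least-n _) (n∣lcm[m,n] p q) i))
    minimal : ∀ r → IsPeriod K (lcm m n) r → lcm p q ≤ r
    minimal r (r>0 , invariant) = ∣⇒≤ {{>-nonZero r>0}} (lcm-least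
      (to (leastPeriod-∣⇔ least-m r) (λ i → ∣ᵤ⇒∣ (proj₁ (to (lcm-∣⇔ {m} {n}) (invariant i)))))
      (to (leastPeriod-∣⇔ least-n r) (λ i → ∣ᵤ⇒∣ (proj₂ (to (lcm-∣⇔ {m} {n}) (invariant i))))))

  omega-lcm : ∀ s t {a b u} → IsRankOfApparition K m a → IsRankOfApparition K n b →
              IsLeastPeriod K m (s ℕ.* a) → IsLeastPeriod K n (t ℕ.* b) →
              lcm (s ℕ.* a) (t ℕ.* b) ≡ u ℕ.* lcm a b → Omega K (lcm m n) u
  omega-lcm _ _ rank-m rank-n least-m least-n lcm≡ = leastPeriod⇒omega (isRank-lcm rank-m rank-n)
    (subst (IsLeastPeriod K (lcm m n)) lcm≡ (leastPeriod-lcm least-m least-n))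

  omega-lcm-equal : ∀ {t} → Omega K m t → Omega K n t → Omega K (lcm m n) t
  omega-lcm-equal {t} ωm ωn with omega⇒leastPeriod ωm | omega⇒leastPeriod ωn
  ... | a , rank-m , least-m | b , rank-n , least-n =
    omega-lcm t t rank-m rank-n least-m least-n (lcm[ta,tb]≡t*lcm[a,b] t a b)

  omega-lcm-2-4 : Even K → 2 ≤ m → Omega K m 2 → Omega K n 4 → Omega K (lcm m n) 2
  omega-lcm-2-4 2∣K m≥2 ωm ωn with omega⇒leastPeriod ωm | omega⇒leastPeriod ωn
  ... | a , rank-m , least-m | b , rank-n , least-n =
    omega-lcm 2 4 rank-m rank-n least-m least-n
      (lcm[2a,4b]≡2*lcm[a,b] (rank-even 2∣K m≥2 rank-m least-m ∣-refl) (rank-odd rank-n least-n))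

  omega-lcm-1 : Even K → 2 ≤ m → Omega K m 1 → Omega K n 2 ⊎ Omega K n 4 →
                Omega K (lcm m n) 1 ⊎ Omega K (lcm m n) 2
  omega-lcm-1 2∣K m≥2 ωm ωn with omega⇒leastPeriod ωm
  ... | a , rank-m , least-m = Sum.[ case-2 , case-4 ] ωn
    where
    via-between : ∀ t {b} → IsRankOfApparition K n b → IsLeastPeriod K n (t ℕ.* b) →
                  t ℕ.* b ∣ 2 ℕ.* lcm a b → Omega K (lcm m n) 1 ⊎ Omega K (lcm m n) 2
    via-between t {b} rank-n least-n tb∣2A =
      Sum.map (omega-lcm 1 t rank-m rank-n least-m least-n)
              (omega-lcm 1 t rank-m rank-n least-m least-n)
        (lcm-between (lcm-pos (proj₁ rank-m) (proj₁ rank-n)) (n∣m*n 1) (n∣m*n t)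
          (∣-trans (*-monoˡ-∣ a (1∣ 2)) (*-monoʳ-∣ 2 (m∣lcm[m,n] a b))) tb∣2A)
    case-2 : Omega K n 2 → Omega K (lcm m n) 1 ⊎ Omega K (lcm m n) 2
    case-2 ω₂ with omega⇒leastPeriod ω₂
    ... | b , rank-n , least-n = via-between 2 rank-n least-n (*-monoʳ-∣ 2 (n∣lcm[m,n] a b))
    case-4 : Omega K n 4 → Omega K (lcm m n) 1 ⊎ Omega K (lcm m n) 2
    case-4 ω₄ with omega⇒leastPeriod ω₄
    ... | b , rank-n , least-n = via-between 4 rank-n least-n
      (4b∣2*lcm[a,b] (rank-even 2∣K m≥2 rank-m least-m (1∣ 2)) (rank-odd rank-n least-n))

omega-lcm-comm : ∀ {K t} m n → Omega K (lcm n m) t → Omega K (lcm m n) t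
omega-lcm-comm {K} {t} m n = subst (λ L → Omega K L t) (lcm-comm n m)

theorem4p30 : (K : ℤ) → Even K → (m n : ℕ) → 2 ≤ m → 2 ≤ n →
    ((t : ℕ) → (t ≡ 1 ⊎ t ≡ 2 ⊎ t ≡ 4) →
        Omega K m t → Omega K n t → Omega K (lcm m n) t)
    × (((Omega K m 2 × Omega K n 4) ⊎ (Omega K m 4 × Omega K n 2)) →
        Omega K (lcm m n) 2)
    × (((Omega K m 1 × (Omega K n 2 ⊎ Omega K n 4))
         ⊎ (Omega K n 1 × (Omega K m 2 ⊎ Omega K m 4))) →
        (Omega K (lcm m n) 1 ⊎ Omega K (lcm m n) 2))
theorem4p30 K 2∣K m n m≥2 n≥2 =
    (λ _ _ → omega-lcm-equal)
  , Sum.[ uncurry (omega-lcm-2-4 2∣K m≥2)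
        , omega-lcm-comm m n ∘ uncurry (flip (omega-lcm-2-4 {m = n} {m} 2∣K n≥2)) ]
  , Sum.[ uncurry (omega-lcm-1 2∣K m≥2)
        , Sum.map (omega-lcm-comm m n) (omega-lcm-comm m n)
            ∘ uncurry (omega-lcm-1 {m = n} {m} 2∣K n≥2) ]
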